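{- For $n\ge0$ let $$\mathcal{N}_n=\{p/q\in\mathcal{K}: p/q \text{ in lowest terms},\ 3^{n-1}<q\le 3^n\},$$ $$\mathcal{P}_m=\{p'/q'\in\mathcal{K}: p'/q' \text{ in lowest terms, with purely periodic 3-adic expansion},\ 3^{m-1}<q'\le 3^m\}.$$ Then for every $n\ge0$, $$\#\mathcal{N}_n\le\sum_{0\le m\le n}2^{n-m}\,\#\mathcal{P}_m.$$
   Context: $\mathcal{K}$ is the triadic Cantor set; every point of $\mathcal{K}$ has a unique 3-adic expansion with digits in $\{0,2\}$. A rational in $\mathcal{K}$ has purely periodic expansion if its digit sequence $(\epsilon_i)_{i\ge1}$ is periodic from the first digit on. -}

module Defs where

open import Data.Nat using (ℕ; zero; suc; _+_; _*_; _^_; _≤_; _<_)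
open import Data.Nat.Coprimality using (Coprime)
open import Data.Bool using (Bool; true; false)
open import Data.Product using (Σ; _×_; _,_; ∃)
open import Data.List using (List; length)
open import Data.List.Relation.Unary.Unique.Propositional using (Unique)
open import Data.List.Membership.Propositional using (_∈_)
open import Relation.Binary.PropositionalEquality using (_≡_)

-- A ternary digit sequence with digits in {0,2}: ε i = true means the
-- (i+1)-th digit ε_{i+1} is 2, false means it is 0.
Digits : Set
Digits = ℕ → Bool

digit : Bool → ℕ
digit true  = 2
digit false = 0

-- A ε N = Σ_{i=1}^{N} ε_i 3^{N-i}  (so the partial sum S_N = A ε N / 3^N).
A : Digits → ℕ → ℕ
A ε zero    = 0
A ε (suc N) = 3 * A ε N + digit (ε N)

-- p/q = Σ_{i≥1} ε_i 3^{-i}, expressed exactly: for every N,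
-- 0 ≤ p/q - S_N ≤ 3^{-N}  (the tail Σ_{i>N} ε_i 3^{-i} lies in [0, 3^{-N}]),
-- cleared of denominators.
IsExpansion : ℕ → ℕ → Digits → Set
IsExpansion p q ε = ∀ N → (A ε N * q ≤ p * 3 ^ N) × (p * 3 ^ N ≤ A ε N * q + q)

InK : ℕ → ℕ → Set
InK p q = ∃ λ ε → IsExpansion p q ε

PurelyPeriodicSeq : Digits → Set
PurelyPeriodicSeq ε = ∃ λ k → (1 ≤ k) × (∀ i → ε (i + k) ≡ ε i)

InKPeriodic : ℕ → ℕ → Set
InKPeriodic p q = ∃ λ ε → IsExpansion p q ε × PurelyPeriodicSeq ε

-- 3^{n-1} < q ≤ 3^n, written without negative exponents as 3^n < 3q ≤ 3·3^n
DenomRange : ℕ → ℕ → Set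
DenomRange n q = (3 ^ n < 3 * q) × (q ≤ 3 ^ n)

InN : ℕ → ℕ × ℕ → Set
InN n (p , q) = Coprime p q × DenomRange n q × InK p q

InP : ℕ → ℕ × ℕ → Set
InP m (p , q) = Coprime p q × DenomRange m q × InKPeriodic p q

HasCard : (ℕ × ℕ → Set) → ℕ → Set
HasCard P c = Σ (List (ℕ × ℕ)) λ L →
  Unique L × (length L ≡ c) × (∀ x → (x ∈ L → P x) × (P x → x ∈ L))

sumUpTo : ℕ → (ℕ → ℕ) → ℕ
sumUpTo zero    f = f 0
sumUpTo (suc n) f = sumUpTo n f + f (suc n)

{-# OPTIONS --safe #-}
-- Write q = 3^k q′ with 3 ∤ q′.  Since q ≤ 3^n we have k ≤ n, and shifting the
-- expansion of p/q by k digits gives p/q = (a + p′/q′)/3^k, where a is the value of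
-- the first k digits (one of 2^k possibilities) and p′/q′ ∈ 𝒫_{n-k}: the remainders
-- q·3^N(p′/q′ − S_N) stay in [0, q′] and, as 3 ∤ q′, each one determines both its
-- successor and its predecessor, so by pigeonhole they (and the digits) are purely
-- periodic.  Hence 𝒩_n is covered by the images of 2^{n-m} × 𝒫_m for m ≤ n.
module Submission where

open import Defs
open import Data.Nat
  using (ℕ; zero; suc; _+_; _*_; _^_; _∸_; _≤_; _<_; z≤n; s≤s; s≤s⁻¹; z<s; _≤?_; NonZero; >-nonZero)
open import Data.Nat.Properties
open import Data.Nat.Divisibility
  using (_∣_; divides; _∣?_; _∣0; ∣m+n∣m⇒∣n; ∣m∣n⇒∣m+n; ∣n⇒∣m*n)
open import Data.Nat.Coprimality using (Coprime; coprime-divisor; gcd≡1⇒coprime)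
open import Data.Nat.Induction using (<-rec)
open import Data.Nat.Tactic.RingSolver using (solve-∀)
open import Data.Bool using (true; false)
open import Data.Empty using (⊥-elim)
open import Data.Fin using (toℕ; fromℕ<)
open import Data.Fin.Properties using (pigeonhole; fromℕ<-injective)
open import Data.Product using (_×_; _,_; ∃; ∃₂; proj₁; proj₂)
open import Data.Sum using (inj₁; inj₂)
open import Data.List using (List; []; _∷_; _++_; map; length; cartesianProductWith)
open import Data.List.Properties using (length-++; length-map)
open import Data.List.Membership.Propositional using (_∈_)
open import Data.List.Membership.Propositional.Properties
  using (∈-∃++; ∈-++⁻; ∈-++⁺ˡ; ∈-++⁺ʳ; ∈-cartesianProductWith⁺)
open import Data.List.Relation.Binary.Subset.Propositional using (_⊆_)
open import Data.List.Relation.Unary.Unique.Propositional using (Unique)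
open import Data.List.Relation.Unary.AllPairs using (_∷_)
open import Data.List.Relation.Unary.All using () renaming (lookup to All-lookup)
open import Data.List.Relation.Unary.Any using (here; there)
open import Relation.Nullary using (¬_; yes; no; contradiction)
open import Relation.Binary.PropositionalEquality

module _ {X : Set} where

  unique⊆⇒length≤ : {xs ys : List X} → Unique xs → xs ⊆ ys → length xs ≤ length ys
  unique⊆⇒length≤ {[]}     _            _   = z≤n
  unique⊆⇒length≤ {x ∷ xs} (x∉xs ∷ uxs) sub with ∈-∃++ (sub (here refl))
  ... | ys₁ , ys₂ , refl = begin
    suc (length xs)               ≤⟨ s≤s (unique⊆⇒length≤ uxs xs⊆ys₁ys₂) ⟩
    suc (length (ys₁ ++ ys₂))     ≡⟨ cong suc (length-++ ys₁) ⟩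
    suc (length ys₁ + length ys₂) ≡⟨ sym (+-suc (length ys₁) (length ys₂)) ⟩
    length ys₁ + length (x ∷ ys₂) ≡⟨ sym (length-++ ys₁) ⟩
    length (ys₁ ++ x ∷ ys₂)       ∎
    where
    open ≤-Reasoning
    xs⊆ys₁ys₂ : xs ⊆ ys₁ ++ ys₂
    xs⊆ys₁ys₂ z∈xs with ∈-++⁻ ys₁ (sub (there z∈xs))
    ... | inj₁ z∈ys₁         = ∈-++⁺ˡ z∈ys₁
    ... | inj₂ (here refl)   = ⊥-elim (All-lookup x∉xs z∈xs refl)
    ... | inj₂ (there z∈ys₂) = ∈-++⁺ʳ ys₁ z∈ys₂

module _ {X Y Z : Set} (f : X → Y → Z) where

  length-cartesianProductWith : (xs : List X) (ys : List Y) →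
    length (cartesianProductWith f xs ys) ≡ length xs * length ys
  length-cartesianProductWith []       ys = refl
  length-cartesianProductWith (x ∷ xs) ys = begin
    length (map (f x) ys ++ cartesianProductWith f xs ys)
      ≡⟨ length-++ (map (f x) ys) ⟩
    length (map (f x) ys) + length (cartesianProductWith f xs ys)
      ≡⟨ cong₂ _+_ (length-map (f x) ys) (length-cartesianProductWith xs ys) ⟩
    length ys + length xs * length ys ∎
    where open ≡-Reasoning

module _ {X : Set} (B : ℕ → List X) where

  blocksUpTo : ℕ → List X
  blocksUpTo zero    = B 0
  blocksUpTo (suc n) = blocksUpTo n ++ B (suc n)

  length-blocksUpTo : ∀ n → length (blocksUpTo n) ≡ sumUpTo n (λ m → length (B m))
  length-blocksUpTo zero    = refl
  length-blocksUpTo (suc n) =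
    trans (length-++ (blocksUpTo n)) (cong (_+ length (B (suc n))) (length-blocksUpTo n))

  ∈-blocksUpTo : ∀ {m n x} → m ≤ n → x ∈ B m → x ∈ blocksUpTo n
  ∈-blocksUpTo {n = zero}  z≤n x∈ = x∈
  ∈-blocksUpTo {n = suc n} m≤1+n x∈ with m≤n⇒m<n∨m≡n m≤1+n
  ... | inj₁ m<1+n = ∈-++⁺ˡ (∈-blocksUpTo (s≤s⁻¹ m<1+n) x∈)
  ... | inj₂ refl  = ∈-++⁺ʳ (blocksUpTo n) x∈

sumUpTo-cong : ∀ n {f g : ℕ → ℕ} → (∀ m → m ≤ n → f m ≡ g m) → sumUpTo n f ≡ sumUpTo n g
sumUpTo-cong zero    f≗g = f≗g 0 z≤n
sumUpTo-cong (suc n) f≗g =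
  cong₂ _+_ (sumUpTo-cong n (λ m m≤n → f≗g m (m≤n⇒m≤1+n m≤n))) (f≗g (suc n) ≤-refl)

prefixValues : ℕ → List ℕ
prefixValues zero    = 0 ∷ []
prefixValues (suc k) =
  cartesianProductWith (λ a b → 3 * a + digit b) (prefixValues k) (false ∷ true ∷ [])

length-prefixValues : ∀ k → length (prefixValues k) ≡ 2 ^ k
length-prefixValues zero    = refl
length-prefixValues (suc k) = begin
  length (prefixValues (suc k)) ≡⟨ length-cartesianProductWith _ (prefixValues k) _ ⟩
  length (prefixValues k) * 2   ≡⟨ cong (_* 2) (length-prefixValues k) ⟩
  2 ^ k * 2                     ≡⟨ *-comm (2 ^ k) 2 ⟩
  2 ^ suc k                     ∎
  where open ≡-Reasoning

A∈prefixValues : ∀ ε k → A ε k ∈ prefixValues k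
A∈prefixValues ε zero    = here refl
A∈prefixValues ε (suc k) = ∈-cartesianProductWith⁺ _ (A∈prefixValues ε k) (bool∈ (ε k))
  where
  bool∈ : ∀ b → b ∈ false ∷ true ∷ []
  bool∈ false = here refl
  bool∈ true  = there (here refl)

dropDigits : ℕ → Digits → Digits
dropDigits k ε i = ε (k + i)

A-+ : ∀ ε k N → A ε (k + N) ≡ A ε k * 3 ^ N + A (dropDigits k ε) N
A-+ ε k zero = begin
  A ε (k + 0)   ≡⟨ cong (A ε) (+-identityʳ k) ⟩
  A ε k         ≡⟨ sym (*-identityʳ (A ε k)) ⟩
  A ε k * 1     ≡⟨ sym (+-identityʳ (A ε k * 1)) ⟩
  A ε k * 1 + 0 ∎
  where open ≡-Reasoning
A-+ ε k (suc N) = begin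
  A ε (k + suc N)                        ≡⟨ cong (A ε) (+-suc k N) ⟩
  3 * A ε (k + N) + d                    ≡⟨ cong (λ x → 3 * x + d) (A-+ ε k N) ⟩
  3 * (A ε k * 3 ^ N + A ε′ N) + d       ≡⟨ ring (A ε k) (3 ^ N) (A ε′ N) d ⟩
  A ε k * (3 * 3 ^ N) + (3 * A ε′ N + d) ∎
  where
  open ≡-Reasoning
  ε′ = dropDigits k ε
  d  = digit (ε (k + N))
  ring : ∀ a t b d → 3 * (a * t + b) + d ≡ a * (3 * t) + (3 * b + d)
  ring = solve-∀

module _ {q : ℕ} (s : ℕ → ℕ) (s≤q : ∀ N → s N ≤ q)
         (step   : ∀ {i j} → s i ≡ s j → s (suc i) ≡ s (suc j))
         (unstep : ∀ {i j} → s (suc i) ≡ s (suc j) → s i ≡ s j) where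

  bounded-reversible⇒purelyPeriodic : ∃ λ P → 1 ≤ P × ∀ N → s N ≡ s (N + P)
  bounded-reversible⇒purelyPeriodic
    with i , j , i<j , sᵢ≡sⱼ ← pigeonhole (n<1+n (suc q)) (λ i → fromℕ< (s≤s (s≤q (toℕ i))))
    = P , m<n⇒0<n∸m i<j , forth (back (toℕ i) s[i]≡s[i+P])
    where
    P = toℕ j ∸ toℕ i
    s[i]≡s[i+P] : s (toℕ i) ≡ s (toℕ i + P)
    s[i]≡s[i+P] = trans (fromℕ<-injective _ _ _ _ sᵢ≡sⱼ)
                        (cong s (sym (m+[n∸m]≡n (<⇒≤ i<j))))
    back : ∀ i → s i ≡ s (i + P) → s 0 ≡ s P
    back zero    eq = eq
    back (suc i) eq = back i (unstep eq)
    forth : s 0 ≡ s P → ∀ N → s N ≡ s (N + P)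
    forth eq zero    = eq
    forth eq (suc N) = step (forth eq N)

y+2q≰q : ∀ {q} y → 0 < q → ¬ (y + 2 * q ≤ q)
y+2q≰q {q} y q>0 y+2q≤q = <-irrefl refl (begin-strict
  q         <⟨ m<m+n q q>0 ⟩
  q + q     ≡⟨ cong (q +_) (sym (+-identityʳ q)) ⟩
  2 * q     ≤⟨ m≤n+m (2 * q) y ⟩
  y + 2 * q ≤⟨ y+2q≤q ⟩
  q         ∎)
  where open ≤-Reasoning

3∣y+2q⇒3∣y⇒3∣q : ∀ {y q} → 3 ∣ y + 2 * q → 3 ∣ y → 3 ∣ q
3∣y+2q⇒3∣y⇒3∣q 3∣y+2q 3∣y =
  coprime-divisor (gcd≡1⇒coprime {3} {2} refl) (∣m+n∣m⇒∣n 3∣y+2q 3∣y)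

digit-unique : ∀ {q y y′} b b′ → 0 < q → y ≤ q → y′ ≤ q →
               y + digit b * q ≡ y′ + digit b′ * q → b ≡ b′
digit-unique false false _ _ _ _ = refl
digit-unique true  true  _ _ _ _ = refl
digit-unique {y = y} {y′} true false q>0 _ y′≤q eq =
  ⊥-elim (y+2q≰q y q>0 (≤-trans (≤-reflexive (trans eq (+-identityʳ y′))) y′≤q))
digit-unique false true q>0 y≤q y′≤q eq = sym (digit-unique true false q>0 y′≤q y≤q (sym eq))

digit-unique-mod3 : ∀ {q y x x′} b b′ → ¬ 3 ∣ q →
                    y + digit b * q ≡ 3 * x → y + digit b′ * q ≡ 3 * x′ → b ≡ b′
digit-unique-mod3 false false _ _ _ = refl
digit-unique-mod3 true  true  _ _ _ = refl
digit-unique-mod3 {y = y} {x} {x′} true false 3∤q eq eq′ =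
  ⊥-elim (3∤q (3∣y+2q⇒3∣y⇒3∣q (divides x (trans eq (*-comm 3 x)))
                                (divides x′ (trans (sym (+-identityʳ y)) (trans eq′ (*-comm 3 x′))))))
digit-unique-mod3 {x = x} {x′} false true 3∤q eq eq′ =
  sym (digit-unique-mod3 {x = x′} {x} true false 3∤q eq′ eq)

module Remainder {p q : ℕ} {ε : Digits} (exp : IsExpansion p q ε) where

  -- q · 3^N · (p/q − S_N), i.e. q times the value of the tail after N digits
  remainder : ℕ → ℕ
  remainder N = p * 3 ^ N ∸ A ε N * q

  remainder-+ : ∀ N → remainder N + A ε N * q ≡ p * 3 ^ N
  remainder-+ N = m∸n+n≡m (proj₁ (exp N))

  remainder-≤ : ∀ N → remainder N ≤ q
  remainder-≤ N = m≤n+o⇒m∸n≤o (p * 3 ^ N) (A ε N * q) (proj₂ (exp N))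

  remainder-suc : ∀ N → remainder (suc N) + digit (ε N) * q ≡ 3 * remainder N
  remainder-suc N = +-cancelʳ-≡ (3 * (a * q)) _ _ (begin
    remainder (suc N) + d * q + 3 * (a * q) ≡⟨ regroup (remainder (suc N)) a d q ⟩
    remainder (suc N) + A ε (suc N) * q     ≡⟨ remainder-+ (suc N) ⟩
    p * (3 * 3 ^ N)                         ≡⟨ pull3 p (3 ^ N) ⟩
    3 * (p * 3 ^ N)                         ≡⟨ cong (3 *_) (sym (remainder-+ N)) ⟩
    3 * (remainder N + a * q)               ≡⟨ *-distribˡ-+ 3 (remainder N) (a * q) ⟩
    3 * remainder N + 3 * (a * q)           ∎)
    where
    open ≡-Reasoning
    a = A ε N
    d = digit (ε N)
    regroup : ∀ r a d q → r + d * q + 3 * (a * q) ≡ r + (3 * a + d) * q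
    regroup = solve-∀
    pull3 : ∀ p t → p * (3 * t) ≡ 3 * (p * t)
    pull3 = solve-∀

module _ {p q : ℕ} {ε : Digits} (exp : IsExpansion p q ε) (q>0 : 0 < q) (3∤q : ¬ 3 ∣ q) where

  open Remainder {p} {q} {ε} exp

  private
    remainder-suc-≡ : ∀ {i j} → remainder i ≡ remainder j →
      remainder (suc i) + digit (ε i) * q ≡ remainder (suc j) + digit (ε j) * q
    remainder-suc-≡ {i} {j} eq =
      trans (remainder-suc i) (trans (cong (3 *_) eq) (sym (remainder-suc j)))

  remainder-determines-digit : ∀ {i j} → remainder i ≡ remainder j → ε i ≡ ε j
  remainder-determines-digit {i} {j} eq =
    digit-unique (ε i) (ε j) q>0 (remainder-≤ (suc i)) (remainder-≤ (suc j))
                 (remainder-suc-≡ {i} {j} eq)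

  remainder-step : ∀ {i j} → remainder i ≡ remainder j → remainder (suc i) ≡ remainder (suc j)
  remainder-step {i} {j} eq = +-cancelʳ-≡ (digit (ε j) * q) _ _
    (trans (cong (λ b → remainder (suc i) + digit b * q)
                 (sym (remainder-determines-digit {i} {j} eq)))
           (remainder-suc-≡ {i} {j} eq))

  remainder-unstep : ∀ {i j} → remainder (suc i) ≡ remainder (suc j) → remainder i ≡ remainder j
  remainder-unstep {i} {j} eq = *-cancelˡ-≡ _ _ 3 (begin
    3 * remainder i                     ≡⟨ sym (remainder-suc i) ⟩
    remainder (suc i) + digit (ε i) * q ≡⟨ cong₂ (λ r b → r + digit b * q) eq εi≡εj ⟩
    remainder (suc j) + digit (ε j) * q ≡⟨ remainder-suc j ⟩
    3 * remainder j                     ∎)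
    where
    open ≡-Reasoning
    εi≡εj : ε i ≡ ε j
    εi≡εj = digit-unique-mod3 {x = remainder i} {remainder j} (ε i) (ε j) 3∤q
              (remainder-suc i) (trans (cong (_+ digit (ε j) * q) eq) (remainder-suc j))

  expansion-purelyPeriodic : PurelyPeriodicSeq ε
  expansion-purelyPeriodic
    with P , P≥1 , periodic ← bounded-reversible⇒purelyPeriodic
                                remainder remainder-≤
                                (λ {i j} → remainder-step {i} {j})
                                (λ {i j} → remainder-unstep {i} {j})
    = P , P≥1 , λ N → sym (remainder-determines-digit {N} {N + P} (periodic N))

split-3-power : ∀ q → 0 < q → ∃₂ λ k q′ → q ≡ 3 ^ k * q′ × ¬ 3 ∣ q′
split-3-power = <-rec _ split
  where
  split : ∀ q → (∀ {t} → t < q → 0 < t → ∃₂ λ k q′ → t ≡ 3 ^ k * q′ × ¬ 3 ∣ q′) →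
          0 < q → ∃₂ λ k q′ → q ≡ 3 ^ k * q′ × ¬ 3 ∣ q′
  split q rec q>0 with 3 ∣? q
  ... | no 3∤q                  = 0 , q , sym (+-identityʳ q) , 3∤q
  ... | yes (divides zero refl) = ⊥-elim (<-irrefl refl q>0)
  ... | yes (divides t@(suc _) refl)
    with k , q′ , t≡3^kq′ , 3∤q′ ← rec (m<m*n t 3 (s≤s (s≤s z≤n))) z<s
    = suc k , q′ ,
      trans (*-comm t 3) (trans (cong (3 *_) t≡3^kq′) (sym (*-assoc 3 (3 ^ k) q′))) , 3∤q′

DenomRange-3^* : ∀ {n k q′} → 0 < q′ → DenomRange n (3 ^ k * q′) → k ≤ n × DenomRange (n ∸ k) q′
DenomRange-3^* {n} {k} {q′} q′>0 (lo , hi) = k≤n , lo′ , hi′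
  where
  instance
    3^k≢0 : NonZero (3 ^ k)
    3^k≢0 = m^n≢0 3 k
  k≤n : k ≤ n
  k≤n = ≮⇒≥ λ n<k → <⇒≱ (^-monoʳ-< 3 (s≤s (s≤s z≤n)) n<k)
                         (≤-trans (m≤m*n (3 ^ k) q′ {{>-nonZero q′>0}}) hi)
  3^n≡3^k*3^m : 3 ^ n ≡ 3 ^ k * 3 ^ (n ∸ k)
  3^n≡3^k*3^m = trans (cong (3 ^_) (sym (m+[n∸m]≡n k≤n))) (^-distribˡ-+-* 3 k (n ∸ k))
  lo′ : 3 ^ (n ∸ k) < 3 * q′
  lo′ = *-cancelˡ-< (3 ^ k) _ _
          (subst₂ _<_ 3^n≡3^k*3^m (trans (sym (*-assoc 3 (3 ^ k) q′))
            (trans (cong (_* q′) (*-comm 3 (3 ^ k))) (*-assoc (3 ^ k) 3 q′))) lo)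
  hi′ : q′ ≤ 3 ^ (n ∸ k)
  hi′ = *-cancelˡ-≤ (3 ^ k) (subst (3 ^ k * q′ ≤_) 3^n≡3^k*3^m hi)

-- (a + p′/q′)/3^k: k leading digits of value a followed by the expansion of p′/q′
prependDigits : ℕ → ℕ → ℕ × ℕ → ℕ × ℕ
prependDigits k a (p′ , q′) = a * q′ + p′ , 3 ^ k * q′

prefix-≤ : ∀ {p q} ε k → IsExpansion p (3 ^ k * q) ε → A ε k * q ≤ p
prefix-≤ {p} {q} ε k exp =
  *-cancelˡ-≤ (3 ^ k) {{m^n≢0 3 k}}
    (subst₂ _≤_ (swap (A ε k) (3 ^ k) q) (*-comm p (3 ^ k)) (proj₁ (exp k)))
  where
  swap : ∀ a t q → a * (t * q) ≡ t * (a * q)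
  swap = solve-∀

expansion-dropDigits : ∀ {p′ q} ε k →
  IsExpansion (A ε k * q + p′) (3 ^ k * q) ε → IsExpansion p′ q (dropDigits k ε)
expansion-dropDigits {p′} {q} ε k exp N =
  +-cancelˡ-≤ (a * s * q) _ _ (*-cancelˡ-≤ t (subst₂ _≤_ partial scaled (proj₁ (exp (k + N))))) ,
  +-cancelˡ-≤ (a * s * q) _ _ (*-cancelˡ-≤ t (subst₂ _≤_ scaled partial+q (proj₂ (exp (k + N)))))
  where
  t = 3 ^ k
  s = 3 ^ N
  a = A ε k
  b = A (dropDigits k ε) N
  instance
    t≢0 : NonZero t
    t≢0 = m^n≢0 3 k
  partial : A ε (k + N) * (t * q) ≡ t * (a * s * q + b * q)
  partial = trans (cong (_* (t * q)) (A-+ ε k N)) (ring a s b t q)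
    where
    ring : ∀ a s b t q → (a * s + b) * (t * q) ≡ t * (a * s * q + b * q)
    ring = solve-∀
  partial+q : A ε (k + N) * (t * q) + t * q ≡ t * (a * s * q + (b * q + q))
  partial+q = trans (cong (λ x → x * (t * q) + t * q) (A-+ ε k N)) (ring a s b t q)
    where
    ring : ∀ a s b t q → (a * s + b) * (t * q) + t * q ≡ t * (a * s * q + (b * q + q))
    ring = solve-∀
  scaled : (a * q + p′) * 3 ^ (k + N) ≡ t * (a * s * q + p′ * s)
  scaled = trans (cong ((a * q + p′) *_) (^-distribˡ-+-* 3 k N)) (ring a s t q p′)
    where
    ring : ∀ a s t q p′ → (a * q + p′) * (t * s) ≡ t * (a * s * q + p′ * s)
    ring = solve-∀

coprime-prependDigits⁻ : ∀ {k a p′ q′} → Coprime (a * q′ + p′) (3 ^ k * q′) → Coprime p′ q′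
coprime-prependDigits⁻ {k} {a} coprime (d∣p′ , d∣q′) =
  coprime (∣m∣n⇒∣m+n (∣n⇒∣m*n a d∣q′) d∣p′ , ∣n⇒∣m*n (3 ^ k) d∣q′)

∤⇒>0 : ∀ {d n} → ¬ d ∣ n → 0 < n
∤⇒>0 {d} d∤n = n≢0⇒n>0 λ { refl → d∤n (d ∣0) }

InN⇒prependDigits : ∀ {n x} → InN n x →
  ∃ λ k → k ≤ n × ∃₂ λ a y → a ∈ prefixValues k × InP (n ∸ k) y × x ≡ prependDigits k a y
InN⇒prependDigits {n} {p , q} (coprime , range , ε , exp)
  with k , q′ , refl , 3∤q′ ← split-3-power q
                                 (*-cancelˡ-< 3 0 q (<-trans (m^n>0 3 n) (proj₁ range)))
  with p′ , refl ← m≤n⇒∃[o]m+o≡n {n = p} (prefix-≤ ε k exp)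
  with k≤n , range′ ← DenomRange-3^* (∤⇒>0 3∤q′) range
  = k , k≤n , A ε k , (p′ , q′) , A∈prefixValues ε k ,
    (coprime-prependDigits⁻ {k} {A ε k} coprime , range′ ,
     dropDigits k ε , exp′ , expansion-purelyPeriodic {p′} exp′ (∤⇒>0 3∤q′) 3∤q′) ,
    refl
  where
  exp′ : IsExpansion p′ q′ (dropDigits k ε)
  exp′ = expansion-dropDigits ε k exp

module _ {P : ℕ → ℕ × ℕ → Set} {b : ℕ → ℕ} {n : ℕ}
         (card : ∀ m → m ≤ n → HasCard (P m) (b m)) where

  -- junk value [] for m > n
  enumeration : ℕ → List (ℕ × ℕ)
  enumeration m with m ≤? n
  ... | yes m≤n = proj₁ (card m m≤n)
  ... | no  _   = []

  length-enumeration : ∀ {m} → m ≤ n → length (enumeration m) ≡ b m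
  length-enumeration {m} m≤n with m ≤? n
  ... | yes m≤n′ = proj₁ (proj₂ (proj₂ (card m m≤n′)))
  ... | no  m≰n  = contradiction m≤n m≰n

  enumeration-complete : ∀ {m x} → m ≤ n → P m x → x ∈ enumeration m
  enumeration-complete {m} {x} m≤n Px with m ≤? n
  ... | yes m≤n′ = proj₂ (proj₂ (proj₂ (proj₂ (card m m≤n′))) x) Px
  ... | no  m≰n  = contradiction m≤n m≰n

lemma6p3 : (n a : ℕ) (b : ℕ → ℕ) → HasCard (InN n) a
         → (∀ m → m ≤ n → HasCard (InP m) (b m))
         → a ≤ sumUpTo n (λ m → 2 ^ (n ∸ m) * b m)
lemma6p3 n a b (𝒩 , unique𝒩 , |𝒩|≡a , enumerates𝒩) card = begin
  a                                   ≡⟨ sym |𝒩|≡a ⟩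
  length 𝒩                            ≤⟨ unique⊆⇒length≤ unique𝒩 𝒩⊆blocks ⟩
  length (blocksUpTo block n)         ≡⟨ length-blocksUpTo block n ⟩
  sumUpTo n (λ m → length (block m))  ≡⟨ sumUpTo-cong n length-block ⟩
  sumUpTo n (λ m → 2 ^ (n ∸ m) * b m) ∎
  where
  open ≤-Reasoning
  blockWith : ℕ → ℕ → List (ℕ × ℕ)
  blockWith k m = cartesianProductWith (prependDigits k) (prefixValues k) (enumeration card m)
  block : ℕ → List (ℕ × ℕ)
  block m = blockWith (n ∸ m) m
  length-block : ∀ m → m ≤ n → length (block m) ≡ 2 ^ (n ∸ m) * b m
  length-block m m≤n = trans (length-cartesianProductWith _ (prefixValues (n ∸ m)) _)
    (cong₂ _*_ (length-prefixValues (n ∸ m)) (length-enumeration card m≤n))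
  𝒩⊆blocks : 𝒩 ⊆ blocksUpTo block n
  𝒩⊆blocks x∈𝒩
    with k , k≤n , w , y , w∈ , y∈𝒫 , refl ← InN⇒prependDigits {n} (proj₁ (enumerates𝒩 _) x∈𝒩)
    = ∈-blocksUpTo block (m∸n≤m n k)
        (subst (λ j → prependDigits k w y ∈ blockWith j (n ∸ k)) (sym (m∸[m∸n]≡n k≤n))
          (∈-cartesianProductWith⁺ (prependDigits k) w∈
            (enumeration-complete card (m∸n≤m n k) y∈𝒫)))
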